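{- Let $\mathcal{K}$ be a regular incidence complex of rank $n\ge 1$, let $\Gamma$ be a flag-transitive subgroup of $\Gamma(\mathcal{K})$, and let $\Phi=\{F_{ -1},F_0,\dots,F_n\}$ be a flag of $\mathcal{K}$ with $F_i$ of rank $i$. For $i\in\{ -1,0,\dots,n\}$ let $R_i=\{\varphi\in\Gamma: F_j\varphi=F_j\text{ for all } j\ne i\}$. Then for all $i,j$ with $-1\le i<j-1\le n-1$ we have $R_iR_j=\langle R_i,R_j\rangle=R_jR_i$ (products of subsets of $\Gamma$).
   Context: A partially ordered set $\mathcal{K}$ is an incidence complex of rank $n$ if: (I1) it has a least face and a greatest face; (I2) every chain is contained in a maximal chain (flag) with exactly $n+2$ elements (giving a rank function with values $-1,\dots,n$, each flag containing one face of each rank); (I3) every section $G/F=\{H: F\le H\le G\}$ (including $\mathcal{K}$) is connected, where a poset of rank $\le1$ is connected and one of rank $\ge2$ is connected if any two proper faces are joined by a finite sequence of proper faces with consecutive members comparable; (I4) for $i=0,\dots,n-1$, whenever $F<G$ with ranks $i-1$ and $i+1$ there are at least two $i$-faces strictly between them. $\Gamma(\mathcal{K})$ is the group of order-preserving bijections $\mathcal{K}\to\mathcal{K}$ (with order-preserving inverse); $\mathcal{K}$ is regular if $\Gamma(\mathcal{K})$ is transitive on flags; a subgroup $\Gamma\le\Gamma(\mathcal{K})$ is flag-transitive if it is transitive on flags. Automorphisms act on the right. -}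

module Defs where

open import Data.Nat as ℕ using (ℕ; zero; suc; _∸_)
open import Data.Fin as Fin using (Fin; toℕ)
open import Data.Product using (Σ; ∃; ∃₂; _×_; _,_)
open import Data.Sum using (_⊎_)
open import Data.Unit using (⊤)
open import Relation.Binary.PropositionalEquality using (_≡_; _≢_)
open import Relation.Binary.Structures using (IsPartialOrder)
open import Function.Definitions using (Injective)

-- Ranks −1,0,…,n are encoded by Fin (2 + n): index k stands for rank k − 1.

module PosetNotions {Face : Set} (_≤_ : Face → Face → Set) where

  _<_ : Face → Face → Set
  x < y = (x ≤ y) × (x ≢ y)

  Subset : Set₁
  Subset = Face → Set

  _⊆_ : Subset → Subset → Set
  C ⊆ D = ∀ x → C x → D x

  IsChain : Subset → Set
  IsChain C = ∀ x y → C x → C y → (x ≤ y) ⊎ (y ≤ x)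

  IsFlag : Subset → Set₁
  IsFlag C = IsChain C × (∀ D → IsChain D → C ⊆ D → D ⊆ C)

  Image : {m : ℕ} → (Fin m → Face) → Subset
  Image f x = ∃ λ k → f k ≡ x

  HasExactly : Subset → ℕ → Set
  HasExactly C m = Σ (Fin m → Face) λ f → Injective _≡_ _≡_ f × (C ⊆ Image f) × (Image f ⊆ C)

  StrictlyIncreasing : {m : ℕ} → (Fin m → Face) → Set
  StrictlyIncreasing f = ∀ i j → i Fin.< j → f i < f j

  HasRank : (n : ℕ) → Face → Fin (suc (suc n)) → Set₁
  HasRank n F k = Σ (Fin (suc (suc n)) → Face) λ f →
    StrictlyIncreasing f × IsFlag (Image f) × (f k ≡ F)

  Proper : Face → Face → Subset
  Proper F G H = (F < H) × (H < G)

  data Path (P : Subset) (x : Face) : Face → Set where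
    here : Path P x x
    step : ∀ {y z} → Path P x y → P z → (y ≤ z) ⊎ (z ≤ y) → Path P x z

  SectionConnected : Face → Face → Set
  SectionConnected F G = ∀ H H' → Proper F G H → Proper F G H' → Path (Proper F G) H H'

record IncidenceComplex (n : ℕ) : Set₁ where
  field
    Face : Set
    _≤_ : Face → Face → Set
    isPartialOrder : IsPartialOrder _≡_ _≤_
  open PosetNotions _≤_ public
  field
    least : ∃ λ F → ∀ G → F ≤ G
    greatest : ∃ λ G → ∀ F → F ≤ G
    chainInFlag : ∀ C → IsChain C → ∃ λ D → IsFlag D × (C ⊆ D)
    flagSize : ∀ D → IsFlag D → HasExactly D (suc (suc n))
    -- (I3): sections of rank ≥ 2 (rank G − rank F − 1 ≥ 2) are connected;
    -- sections of rank ≤ 1 are connected by convention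
    sectionsConnected : ∀ F G k l → F ≤ G → HasRank n F k → HasRank n G l →
      3 ℕ.≤ (toℕ l ∸ toℕ k) → SectionConnected F G
    diamond : ∀ F G k l → HasRank n F k → HasRank n G l → toℕ l ≡ suc (suc (toℕ k)) →
      F < G → ∃₂ λ H H' → (H ≢ H') × Proper F G H × Proper F G H' ×
        (∃ λ m → (toℕ m ≡ suc (toℕ k)) × HasRank n H m × HasRank n H' m)

module _ {n : ℕ} (K : IncidenceComplex n) where
  open IncidenceComplex K

  record Aut : Set where
    field
      to : Face → Face
      from : Face → Face
      from-to : ∀ x → from (to x) ≡ x
      to-from : ∀ x → to (from x) ≡ x
      to-mono : ∀ {x y} → x ≤ y → to x ≤ to y
      from-mono : ∀ {x y} → x ≤ y → from x ≤ from y
  open Aut public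

  _≈_ : Aut → Aut → Set
  φ ≈ ψ = ∀ x → to φ x ≡ to ψ x

  idA : Aut
  idA = record { to = λ x → x ; from = λ x → x ; from-to = λ _ → Relation.Binary.PropositionalEquality.refl
               ; to-from = λ _ → Relation.Binary.PropositionalEquality.refl ; to-mono = λ p → p ; from-mono = λ p → p }

  -- right action: F (φ · ψ) = (F φ) ψ
  _·_ : Aut → Aut → Aut
  φ · ψ = record
    { to = λ x → to ψ (to φ x)
    ; from = λ x → from φ (from ψ x)
    ; from-to = λ x → Relation.Binary.PropositionalEquality.trans
        (Relation.Binary.PropositionalEquality.cong (from φ) (from-to ψ (to φ x))) (from-to φ x)
    ; to-from = λ x → Relation.Binary.PropositionalEquality.trans
        (Relation.Binary.PropositionalEquality.cong (to ψ) (to-from φ (from ψ x))) (to-from ψ x)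
    ; to-mono = λ p → to-mono ψ (to-mono φ p)
    ; from-mono = λ p → from-mono φ (from-mono ψ p)
    }

  _⁻¹ : Aut → Aut
  φ ⁻¹ = record { to = from φ ; from = to φ ; from-to = to-from φ ; to-from = from-to φ
                ; to-mono = from-mono φ ; from-mono = to-mono φ }

  AutSet : Set₁
  AutSet = Aut → Set

  record IsSubgroup (S : AutSet) : Set where
    field
      resp : ∀ {φ ψ} → φ ≈ ψ → S φ → S ψ
      has-id : S idA
      has-· : ∀ {φ ψ} → S φ → S ψ → S (φ · ψ)
      has-⁻¹ : ∀ {φ} → S φ → S (φ ⁻¹)

  MapsOnto : Aut → Subset → Subset → Set
  MapsOnto φ C D = (∀ x → C x → D (to φ x)) × (∀ y → D y → C (from φ y))

  FlagTransitive : AutSet → Set₁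
  FlagTransitive S = ∀ C D → IsFlag C → IsFlag D → ∃ λ φ → S φ × MapsOnto φ C D

  Regular : Set₁
  Regular = FlagTransitive (λ _ → ⊤)

  _⋆_ : AutSet → AutSet → AutSet
  (A ⋆ B) φ = ∃₂ λ α β → A α × B β × (φ ≈ (α · β))

  data ⟨_,_⟩ (A B : AutSet) : AutSet where
    inl : ∀ {φ} → A φ → ⟨ A , B ⟩ φ
    inr : ∀ {φ} → B φ → ⟨ A , B ⟩ φ
    e : ⟨ A , B ⟩ idA
    mul : ∀ {φ ψ} → ⟨ A , B ⟩ φ → ⟨ A , B ⟩ ψ → ⟨ A , B ⟩ (φ · ψ)
    inv : ∀ {φ} → ⟨ A , B ⟩ φ → ⟨ A , B ⟩ (φ ⁻¹)
    resp : ∀ {φ ψ} → φ ≈ ψ → ⟨ A , B ⟩ φ → ⟨ A , B ⟩ ψ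

  _≐_ : AutSet → AutSet → Set
  A ≐ B = (∀ φ → A φ → B φ) × (∀ φ → B φ → A φ)

  -- R_i for a base flag Φ (indices shifted by one)
  R : (Γ : AutSet) → (Fin (suc (suc n)) → Face) → Fin (suc (suc n)) → AutSet
  R Γ Φ i φ = Γ φ × (∀ j → j ≢ i → to φ (Φ j) ≡ Φ j)

-- Every chain sits inside a flag with N faces, so by
-- pigeonhole no chain has N + 1 distinct faces.  Splicing two listed flags
-- then shows that ranks are monotone, hence Φ itself is increasing, every
-- increasing listing of length N is a flag, and an automorphism carrying one
-- listed flag onto another matches them position by position.
--
-- Every φ ∈ ⟨R_i, R_j⟩ fixes all F_k, k ≠ i, j.
-- For such φ, replacing F_i in Φ by F_i φ⁻¹ gives a flag Φ' (a face F_m with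
-- i < m < j, fixed by φ, separates the two changed positions).  A map α ∈ Γ
-- carrying Φ' to Φ lies in R_i, and β = α⁻¹φ lies in R_j, so φ = αβ.  The
-- equality with R_j R_i follows by applying this to φ⁻¹.
module Submission where

open import Defs
open import Data.Nat using (ℕ; suc; _≤_; _<_)
open import Data.Fin using (Fin; toℕ)
open import Data.Product using (_×_)

import Data.Nat as ℕ
import Data.Nat.Properties as ℕP
import Data.Fin as F
import Data.Fin.Properties as FP
open import Data.Vec.Functional using (updateAt)
open import Data.Vec.Functional.Properties using (updateAt-updates; updateAt-minimal)
open import Data.Product using (∃; ∃₂; _,_; proj₁; proj₂)
open import Data.Sum using (inj₁; inj₂)
open import Data.Empty using (⊥-elim)
open import Relation.Nullary using (¬_; yes; no)
open import Relation.Binary.PropositionalEquality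
  using (_≡_; _≢_; refl; sym; trans; cong; subst; subst₂; module ≡-Reasoning)
open import Relation.Binary.Structures using (IsPartialOrder)

module Flags {n : ℕ} (K : IncidenceComplex n) where
  open IncidenceComplex K renaming (_≤_ to _⊑_; _<_ to _⊏_)
  open IsPartialOrder isPartialOrder using (reflexive) renaming (trans to ⊑-trans)

  N : ℕ
  N = suc (suc n)

  ⊑-⊏-trans : ∀ {x y z} → x ⊑ y → y ⊏ z → x ⊏ z
  ⊑-⊏-trans x⊑y (y⊑z , y≢z) = ⊑-trans x⊑y y⊑z ,
    λ { refl → y≢z (IsPartialOrder.antisym isPartialOrder y⊑z x⊑y) }

  ⊏-trans : ∀ {x y z} → x ⊏ y → y ⊏ z → x ⊏ z
  ⊏-trans (x⊑y , _) y⊏z = ⊑-⊏-trans x⊑y y⊏z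

  increasing⇒monotone : ∀ {m} {f : Fin m → Face} → StrictlyIncreasing f →
    ∀ {k l} → toℕ k ℕ.≤ toℕ l → f k ⊑ f l
  increasing⇒monotone si {k} {l} k≤l with ℕP.m≤n⇒m<n∨m≡n k≤l
  ... | inj₁ k<l = proj₁ (si k l k<l)
  ... | inj₂ k≡l = reflexive (cong _ (FP.toℕ-injective k≡l))

  increasing⇒chain : ∀ {m} {f : Fin m → Face} → StrictlyIncreasing f → IsChain (Image f)
  increasing⇒chain si _ _ (k , refl) (l , refl) with ℕP.≤-total (toℕ k) (toℕ l)
  ... | inj₁ k≤l = inj₁ (increasing⇒monotone si k≤l)
  ... | inj₂ l≤k = inj₂ (increasing⇒monotone si l≤k)

  image-increasing : (ψ : Aut K) → ∀ {m} {f : Fin m → Face} → StrictlyIncreasing f →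
    StrictlyIncreasing (λ k → to ψ (f k))
  image-increasing ψ {f = f} si k l k<l =
    to-mono ψ (proj₁ (si k l k<l)) ,
    λ same → proj₂ (si k l k<l)
      (trans (sym (from-to ψ (f k))) (trans (cong (from ψ) same) (from-to ψ (f l))))

  enumerate : ∀ C → IsChain C → ∃ λ (list : Fin N → Face) → C ⊆ Image list
  enumerate C chain with chainInFlag C chain
  ... | D , D-flag , C⊆D with flagSize D D-flag
  ...   | list , _ , D⊆list , _ = list , λ x x∈C → D⊆list x (C⊆D x x∈C)

  collision : ∀ C → IsChain C → (h : Fin (suc N) → Face) → (∀ r → C (h r)) →
    ∃₂ λ r s → r F.< s × h r ≡ h s
  collision C chain h inC with enumerate C chain
  ... | list , C⊆list with FP.pigeonhole (ℕP.n<1+n N) (λ r → proj₁ (C⊆list (h r) (inC r)))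
  ...   | r , s , r<s , same = r , s , r<s , (begin
      h r                 ≡⟨ sym (located r) ⟩
      list (position r)   ≡⟨ cong list same ⟩
      list (position s)   ≡⟨ located s ⟩
      h s                 ∎)
    where
      open ≡-Reasoning
      position : Fin (suc N) → Fin N
      position r = proj₁ (C⊆list (h r) (inC r))
      located : ∀ r → list (position r) ≡ h r
      located r = proj₂ (C⊆list (h r) (inC r))

  no-long-chain : (h : Fin (suc N) → Face) → ¬ StrictlyIncreasing h
  no-long-chain h si with collision (Image h) (increasing⇒chain si) h (λ r → r , refl)
  ... | r , s , r<s , hr≡hs = proj₂ (si r s r<s) hr≡hs

  increasing⇒flag : ∀ {Θ : Fin N → Face} → StrictlyIncreasing Θ → IsFlag (Image Θ)
  increasing⇒flag {Θ} si = increasing⇒chain si , maximal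
    where
      maximal : ∀ D → IsChain D → Image Θ ⊆ D → D ⊆ Image Θ
      maximal D chain Θ⊆D x x∈D = located (collision D chain extended inD)
        where
          extended : Fin (suc N) → Face
          extended F.zero = x
          extended (F.suc k) = Θ k
          inD : ∀ r → D (extended r)
          inD F.zero = x∈D
          inD (F.suc k) = Θ⊆D (Θ k) (k , refl)
          located : (∃₂ λ r s → r F.< s × extended r ≡ extended s) → Image Θ x
          located (F.zero , F.suc l , _ , x≡Θl) = l , sym x≡Θl
          located (F.suc k , F.suc l , k<l , Θk≡Θl) = ⊥-elim (proj₂ (si k l (ℕ.s<s⁻¹ k<l)) Θk≡Θl)

  -- Splicing two listed flags f, g at position p: positions 0, …, p read f
  -- and positions p + 1, …, N read g one step back.
  module Splice (f g : Fin N → Face) (p : Fin N) where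
    shifted<N : (r : Fin (suc N)) → ¬ toℕ r ℕ.≤ toℕ p → ℕ.pred (toℕ r) ℕ.< N
    shifted<N F.zero r≰p = ⊥-elim (r≰p ℕ.z≤n)
    shifted<N (F.suc r) _ = FP.toℕ<n r

    splice : Fin (suc N) → Face
    splice r with toℕ r ℕ.≤? toℕ p
    ... | yes r≤p = f (F.fromℕ< (ℕP.≤-<-trans r≤p (FP.toℕ<n p)))
    ... | no r≰p = g (F.fromℕ< (shifted<N r r≰p))

    -- If f p ⊑ g q with q < p, the spliced sequence is increasing:
    -- f₀ ⊏ ⋯ ⊏ f_p ⊑ g_q ⊏ g_p ⊏ ⋯ ⊏ g_(N-1).
    splice-increasing : StrictlyIncreasing f → StrictlyIncreasing g →
      ∀ q → f p ⊑ g q → toℕ q ℕ.< toℕ p → StrictlyIncreasing splice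
    splice-increasing sf sg q fp⊑gq q<p r s r<s with toℕ r ℕ.≤? toℕ p | toℕ s ℕ.≤? toℕ p
    ... | yes _ | yes _ =
      sf _ _ (subst₂ ℕ._<_ (sym (FP.toℕ-fromℕ< _)) (sym (FP.toℕ-fromℕ< _)) r<s)
    ... | no r≰p | yes s≤p = ⊥-elim (r≰p (ℕP.<⇒≤ (ℕP.<-≤-trans r<s s≤p)))
    ... | yes r≤p | no s≰p =
      ⊑-⊏-trans (increasing⇒monotone sf (subst (ℕ._≤ toℕ p) (sym (FP.toℕ-fromℕ< _)) r≤p))
        (⊑-⊏-trans fp⊑gq (sg q _ (subst (toℕ q ℕ.<_) (sym (FP.toℕ-fromℕ< _))
          (ℕP.<-≤-trans q<p (ℕP.<⇒≤pred (ℕP.≰⇒> s≰p))))))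
    ... | no r≰p | no _ =
      sg _ _ (subst₂ ℕ._<_ (sym (FP.toℕ-fromℕ< _)) (sym (FP.toℕ-fromℕ< _))
        (ℕP.pred-mono-< {{ℕ.>-nonZero (ℕP.≤-<-trans ℕ.z≤n (ℕP.≰⇒> r≰p))}} r<s))

  -- Ranks are monotone across two listed flags: f p ⊑ g q forces p ≤ q,
  -- since otherwise the splice would be a chain of N + 1 faces.
  rank-monotone : ∀ {f g : Fin N → Face} → StrictlyIncreasing f → StrictlyIncreasing g →
    ∀ p q → f p ⊑ g q → toℕ p ℕ.≤ toℕ q
  rank-monotone {f} {g} sf sg p q fp⊑gq with toℕ p ℕ.≤? toℕ q
  ... | yes p≤q = p≤q
  ... | no p≰q = ⊥-elim (no-long-chain splice (splice-increasing sf sg q fp⊑gq (ℕP.≰⇒> p≰q)))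
    where open Splice f g p

  rank-respects-order : ∀ {F G k l} → HasRank n F k → HasRank n G l → F ⊑ G → toℕ k ℕ.≤ toℕ l
  rank-respects-order {k = k} {l} (f , sf , _ , fk≡F) (g , sg , _ , gl≡G) F⊑G =
    rank-monotone sf sg k l (subst₂ _⊑_ (sym fk≡F) (sym gl≡G) F⊑G)

  flag-increasing : ∀ {Φ : Fin N → Face} → IsFlag (Image Φ) → (∀ k → HasRank n (Φ k) k) →
    StrictlyIncreasing Φ
  flag-increasing {Φ} (chain , _) rank k l k<l with chain (Φ k) (Φ l) (k , refl) (l , refl)
  ... | inj₁ Φk⊑Φl = Φk⊑Φl , λ Φk≡Φl →
    ℕP.<⇒≱ k<l (rank-respects-order (rank l) (rank k) (reflexive (sym Φk≡Φl)))
  ... | inj₂ Φl⊑Φk = ⊥-elim (ℕP.<⇒≱ k<l (rank-respects-order (rank l) (rank k) Φl⊑Φk))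

  carries-positionwise : (α : Aut K) → ∀ {f g : Fin N → Face} →
    StrictlyIncreasing f → StrictlyIncreasing g →
    (∀ x → Image f x → Image g (to α x)) → ∀ k → to α (f k) ≡ g k
  carries-positionwise α {f} {g} sf sg carries k with carries (f k) (k , refl)
  ... | h , gh≡αfk = trans (sym gh≡αfk) (cong g (FP.toℕ-injective (ℕP.≤-antisym h≤k k≤h)))
    where
      sαf : StrictlyIncreasing (λ k → to α (f k))
      sαf = image-increasing α sf
      h≤k : toℕ h ℕ.≤ toℕ k
      h≤k = rank-monotone sg sαf h k (reflexive gh≡αfk)
      k≤h : toℕ k ℕ.≤ toℕ h
      k≤h = rank-monotone sαf sg k h (reflexive (sym gh≡αfk))

  above⇒≢ : ∀ {x y : Fin N} → toℕ x ℕ.< toℕ y → y ≢ x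
  above⇒≢ x<y y≡x = FP.<⇒≢ x<y (sym y≡x)

  -- A listing h agreeing with an increasing f away from position a and with an
  -- increasing g away from position b is increasing, provided f and g agree at
  -- a position m strictly between a and b: the only new comparison is
  -- h a = g a ⊏ g m = f m ⊏ f b = h b.
  glue-increasing : ∀ {f g h : Fin N → Face} {a m b} →
    StrictlyIncreasing f → StrictlyIncreasing g →
    toℕ a ℕ.< toℕ m → toℕ m ℕ.< toℕ b → f m ≡ g m →
    (∀ k → k ≢ a → h k ≡ f k) → (∀ k → k ≢ b → h k ≡ g k) → StrictlyIncreasing h
  glue-increasing {f} {g} {h} {a} {m} {b} sf sg a<m m<b fm≡gm h≈f h≈g k l k<l
    with k FP.≟ b | l FP.≟ b
  ... | no k≢b | no l≢b = subst₂ _⊏_ (sym (h≈g k k≢b)) (sym (h≈g l l≢b)) (sg k l k<l)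
  ... | yes refl | yes refl = ⊥-elim (ℕP.<-irrefl refl k<l)
  ... | yes refl | no _ =
    subst₂ _⊏_ (sym (h≈f k (above⇒≢ a<b))) (sym (h≈f l (above⇒≢ (ℕP.<-trans a<b k<l))))
      (sf k l k<l)
    where
      a<b : toℕ a ℕ.< toℕ b
      a<b = ℕP.<-trans a<m m<b
  ... | no k≢b | yes refl with k FP.≟ a
  ...   | no k≢a =
    subst₂ _⊏_ (sym (h≈f k k≢a)) (sym (h≈f l (above⇒≢ (ℕP.<-trans a<m m<b)))) (sf k l k<l)
  ...   | yes refl =
    subst₂ _⊏_ (sym (h≈g k k≢b)) (sym (h≈f l (above⇒≢ (ℕP.<-trans a<m m<b))))
      (⊏-trans (sg k m a<m) (subst (_⊏ f l) fm≡gm (sf m l m<b)))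

module Subgroups {n : ℕ} (K : IncidenceComplex n) (Γ : AutSet K) (Γ-subgroup : IsSubgroup K Γ) where
  open IncidenceComplex K using (Face; Image; StrictlyIncreasing)
  open Flags K
  open IsSubgroup Γ-subgroup renaming (resp to Γ-resp)

  inverse-fixes : (ψ : Aut K) → ∀ {x} → to ψ x ≡ x → from ψ x ≡ x
  inverse-fixes ψ {x} ψx≡x = trans (cong (from ψ) (sym ψx≡x)) (from-to ψ x)

  FixesAllBut : (Fin N → Face) → Fin N → Fin N → AutSet K
  FixesAllBut Φ a b φ = Γ φ × (∀ k → k ≢ a → k ≢ b → to φ (Φ k) ≡ Φ k)

  generated⊆FixesAllBut : ∀ {Φ a b φ} → ⟨_,_⟩ K (R K Γ Φ a) (R K Γ Φ b) φ → FixesAllBut Φ a b φ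
  generated⊆FixesAllBut (inl (Γφ , fix)) = Γφ , λ k k≢a _ → fix k k≢a
  generated⊆FixesAllBut (inr (Γφ , fix)) = Γφ , λ k _ k≢b → fix k k≢b
  generated⊆FixesAllBut e = has-id , λ _ _ _ → refl
  generated⊆FixesAllBut (mul {ψ = ψ} φ∈ ψ∈)
    with generated⊆FixesAllBut φ∈ | generated⊆FixesAllBut ψ∈
  ... | Γφ , φ-fix | Γψ , ψ-fix =
    has-· Γφ Γψ , λ k k≢a k≢b → trans (cong (to ψ) (φ-fix k k≢a k≢b)) (ψ-fix k k≢a k≢b)
  generated⊆FixesAllBut (inv {φ} φ∈) with generated⊆FixesAllBut φ∈
  ... | Γφ , φ-fix = has-⁻¹ Γφ , λ k k≢a k≢b → inverse-fixes φ (φ-fix k k≢a k≢b)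
  generated⊆FixesAllBut (resp φ≈ψ φ∈) with generated⊆FixesAllBut φ∈
  ... | Γφ , φ-fix = Γ-resp φ≈ψ Γφ , λ k k≢a k≢b → trans (sym (φ≈ψ _)) (φ-fix k k≢a k≢b)

  decomposition : FlagTransitive K Γ → ∀ {Φ : Fin N → Face} → StrictlyIncreasing Φ →
    ∀ {a m b} → toℕ a < toℕ m → toℕ m < toℕ b →
    ∀ {φ} → FixesAllBut Φ a b φ → _⋆_ K (R K Γ Φ a) (R K Γ Φ b) φ
  decomposition transitive {Φ} Φ-increasing {a} {m} {b} a<m m<b {φ} (Γφ , φ-fix) =
    α , β , (Γα , α-fixes) , (Γβ , β-fixes) , λ x → cong (to φ) (sym (from-to α x))
    where
      φ⁻¹-fix : ∀ k → k ≢ a → k ≢ b → from φ (Φ k) ≡ Φ k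
      φ⁻¹-fix k k≢a k≢b = inverse-fixes φ (φ-fix k k≢a k≢b)

      Φ′ : Fin N → Face
      Φ′ = updateAt Φ a (from φ)

      Φ′≈Φ : ∀ k → k ≢ a → Φ′ k ≡ Φ k
      Φ′≈Φ k k≢a = updateAt-minimal k a Φ k≢a

      Φ′≈Φφ⁻¹ : ∀ k → k ≢ b → Φ′ k ≡ from φ (Φ k)
      Φ′≈Φφ⁻¹ k k≢b with k FP.≟ a
      ... | yes refl = updateAt-updates a Φ
      ... | no k≢a = trans (Φ′≈Φ k k≢a) (sym (φ⁻¹-fix k k≢a k≢b))

      Φ′-increasing : StrictlyIncreasing Φ′
      Φ′-increasing = glue-increasing Φ-increasing (image-increasing (_⁻¹ K φ) Φ-increasing)
        a<m m<b (sym (φ⁻¹-fix m (above⇒≢ a<m) (FP.<⇒≢ m<b)))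
        Φ′≈Φ Φ′≈Φφ⁻¹

      carry : ∃ λ α → Γ α × MapsOnto K α (Image Φ′) (Image Φ)
      carry = transitive (Image Φ′) (Image Φ) (increasing⇒flag Φ′-increasing) (increasing⇒flag Φ-increasing)

      α : Aut K
      α = proj₁ carry

      Γα : Γ α
      Γα = proj₁ (proj₂ carry)

      α-carries : ∀ k → to α (Φ′ k) ≡ Φ k
      α-carries = carries-positionwise α Φ′-increasing Φ-increasing (proj₁ (proj₂ (proj₂ carry)))

      α-fixes : ∀ k → k ≢ a → to α (Φ k) ≡ Φ k
      α-fixes k k≢a = trans (cong (to α) (sym (Φ′≈Φ k k≢a))) (α-carries k)

      β : Aut K
      β = _·_ K (_⁻¹ K α) φ

      Γβ : Γ β
      Γβ = has-· (has-⁻¹ Γα) Γφ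

      β-fixes : ∀ k → k ≢ b → to φ (from α (Φ k)) ≡ Φ k
      β-fixes k k≢b = begin
        to φ (from α (Φ k))         ≡⟨ cong (λ y → to φ (from α y)) (sym (α-carries k)) ⟩
        to φ (from α (to α (Φ′ k))) ≡⟨ cong (to φ) (from-to α (Φ′ k)) ⟩
        to φ (Φ′ k)                 ≡⟨ cong (to φ) (Φ′≈Φφ⁻¹ k k≢b) ⟩
        to φ (from φ (Φ k))         ≡⟨ to-from φ (Φ k) ⟩
        Φ k                         ∎
        where open ≡-Reasoning

  R-inverse : ∀ Φ i {ψ} → R K Γ Φ i ψ → R K Γ Φ i (_⁻¹ K ψ)
  R-inverse _ _ {ψ} (Γψ , ψ-fix) = has-⁻¹ Γψ , λ k k≢i → inverse-fixes ψ (ψ-fix k k≢i)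

  swap-by-inverse : ∀ {A B : AutSet K} →
    (∀ {α} → A α → A (_⁻¹ K α)) → (∀ {β} → B β → B (_⁻¹ K β)) →
    ∀ {φ} → _⋆_ K A B (_⁻¹ K φ) → _⋆_ K B A φ
  swap-by-inverse A-inverse B-inverse {φ} (α , β , Aα , Bβ , φ⁻¹≈αβ) =
    _⁻¹ K β , _⁻¹ K α , B-inverse Bβ , A-inverse Aα , λ x → begin
      to φ x                                  ≡⟨ sym (from-to α (to φ x)) ⟩
      from α (to α (to φ x))                  ≡⟨ cong (from α) (sym (from-to β _)) ⟩
      from α (from β (to β (to α (to φ x))))  ≡⟨ cong (λ y → from α (from β y)) (sym (φ⁻¹≈αβ (to φ x))) ⟩
      from α (from β (from φ (to φ x)))       ≡⟨ cong (λ y → from α (from β y)) (from-to φ x) ⟩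
      from α (from β x)                       ∎
    where open ≡-Reasoning

product⊆generated : ∀ {n} {K : IncidenceComplex n} {A B : AutSet K} {φ} →
  _⋆_ K A B φ → ⟨_,_⟩ K A B φ
product⊆generated (α , β , Aα , Bβ , φ≈αβ) = resp (λ x → sym (φ≈αβ x)) (mul (inl Aα) (inr Bβ))

swapped-product⊆generated : ∀ {n} {K : IncidenceComplex n} {A B : AutSet K} {φ} →
  _⋆_ K B A φ → ⟨_,_⟩ K A B φ
swapped-product⊆generated (β , α , Bβ , Aα , φ≈βα) = resp (λ x → sym (φ≈βα x)) (mul (inr Bβ) (inl Aα))

position-between : ∀ {N} (i j : Fin N) → suc (toℕ i) < toℕ j →
  ∃ λ (m : Fin N) → toℕ i < toℕ m × toℕ m < toℕ j
position-between i j i+1<j = F.fromℕ< (ℕP.<-trans i+1<j (FP.toℕ<n j)) ,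
  subst (toℕ i <_) (sym m≡i+1) (ℕP.n<1+n (toℕ i)) , subst (_< toℕ j) (sym m≡i+1) i+1<j
  where m≡i+1 = FP.toℕ-fromℕ< (ℕP.<-trans i+1<j (FP.toℕ<n j))

lemma3p4 : (n : ℕ) → 1 ≤ n → (K : IncidenceComplex n) → Regular K →
    (Γ : AutSet K) → IsSubgroup K Γ → FlagTransitive K Γ →
    (Φ : Fin (suc (suc n)) → IncidenceComplex.Face K) →
    IncidenceComplex.IsFlag K (IncidenceComplex.Image K Φ) →
    (∀ k → IncidenceComplex.HasRank K n (Φ k) k) →
    ∀ (i j : Fin (suc (suc n))) → suc (toℕ i) < toℕ j →
    (_≐_ K (_⋆_ K (R K Γ Φ i) (R K Γ Φ j)) (⟨_,_⟩ K (R K Γ Φ i) (R K Γ Φ j)))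
    × (_≐_ K (⟨_,_⟩ K (R K Γ Φ i) (R K Γ Φ j)) (_⋆_ K (R K Γ Φ j) (R K Γ Φ i)))
lemma3p4 n _ K _ Γ Γ-subgroup transitive Φ Φ-flag Φ-rank i j i+1<j =
  ((λ _ → product⊆generated) , generated⊆product) ,
  ((λ φ φ∈ → swap-by-inverse (R-inverse Φ i) (R-inverse Φ j) {φ} (generated⊆product _ (inv φ∈))) ,
   (λ _ → swapped-product⊆generated))
  where
    open Flags K
    open Subgroups K Γ Γ-subgroup
    m : ∃ λ (m : Fin (suc (suc n))) → toℕ i < toℕ m × toℕ m < toℕ j
    m = position-between i j i+1<j

    generated⊆product : ∀ φ → ⟨_,_⟩ K (R K Γ Φ i) (R K Γ Φ j) φ → _⋆_ K (R K Γ Φ i) (R K Γ Φ j) φ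
    generated⊆product _ φ∈ =
      decomposition transitive (flag-increasing Φ-flag Φ-rank)
        (proj₁ (proj₂ m)) (proj₂ (proj₂ m)) (generated⊆FixesAllBut {Φ} {i} {j} φ∈)
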